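{- For all nonnegative integers $a \leq n$, \[ F(G(n,a)) = \begin{cases} 1 & n < 3, \\ \binom{n}{a} & n \geq 3. \end{cases} \]
   Context: For nonnegative integers $a \le n$, $G(n,a)$ denotes the graph obtained from the complete bipartite graph $K_{a,n-a}$ (parts of sizes $a$ and $n-a$) by removing the edges of a maximal matching. For a finite graph $G$, a permutation of the vertices of $G$ is a sequence listing every vertex of $G$ exactly once; two such permutations $\pi,\sigma$ are $G$-different if there is an index $i$ such that $\{\pi(i),\sigma(i)\}$ is an edge of $G$; $F(G)$ denotes the maximum size of a family of pairwise $G$-different permutations of the vertices of $G$. -}

module Defs where

open import Data.Nat using (ℕ; _+_; _<_; _≤_)
open import Data.Fin using (Fin; toℕ)
open import Data.Product using (_×_; ∃)
open import Data.Sum using (_⊎_)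
open import Data.List using (List; length)
open import Data.List.Relation.Unary.All using (All)
open import Data.List.Relation.Unary.AllPairs using (AllPairs)
open import Relation.Binary.PropositionalEquality using (_≡_; _≢_)
open import Function.Definitions using (Injective)

-- Vertices of G(n,a) are Fin n; part A = {i | toℕ i < a}, part B = {j | a ≤ toℕ j}.
-- The removed maximal matching is {i , a + i} for all i with i < a and a + i < n
-- (i.e. i < min(a, n - a)); this is a maximal (indeed maximum) matching of K_{a,n-a}.
CrossEdge : (n a : ℕ) → Fin n → Fin n → Set
CrossEdge n a u v = (toℕ u < a) × (a ≤ toℕ v) × (toℕ v ≢ a + toℕ u)

Adj : (n a : ℕ) → Fin n → Fin n → Set
Adj n a u v = CrossEdge n a u v ⊎ CrossEdge n a v u

-- A permutation of the vertices: a sequence (position ↦ vertex) listing each vertex once.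
IsPermutation : {n : ℕ} → (Fin n → Fin n) → Set
IsPermutation f = Injective _≡_ _≡_ f

GDifferent : (n a : ℕ) → (Fin n → Fin n) → (Fin n → Fin n) → Set
GDifferent n a π σ = ∃ λ (i : Fin n) → Adj n a (π i) (σ i)

IsGDiffFamily : (n a : ℕ) → List (Fin n → Fin n) → Set
IsGDiffFamily n a fam = All IsPermutation fam × AllPairs (GDifferent n a) fam

FIs : (n a k : ℕ) → Set
FIs n a k =
  (∃ λ (fam : List (Fin n → Fin n)) → IsGDiffFamily n a fam × length fam ≡ k)
  × (∀ (fam : List (Fin n → Fin n)) → IsGDiffFamily n a fam → length fam ≤ k)

module Submission where

-- The *profile* of a permutation π is the binary word whose i-th
-- letter says whether π(i) lies in the part A.  Every edge of G(n,a) joins A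
-- to B, so G-different permutations have different profiles; and each profile has
-- weight |A| = a (the weight is invariant under the reindexing by π).  A family of
-- pairwise different words of length n and weight a has at most n C a members, by
-- splitting it according to the first letter (Pascal's rule).
--
-- Lower bound, for n ≥ 3, by induction on n.  For G(k+1, b+1) pick an edge {x, y}
-- with x ∈ A, y ∈ B, and embeddings G(k,b) → G(k+1,b+1) - x and
-- G(k,b+1) → G(k+1,b+1) - y.  Putting x (resp. y) in front of the embedded members
-- of optimal families for the two smaller graphs gives a family of size
-- k C b + k C (b+1) = (k+1) C (b+1).  The base n = 3 is an explicit cyclic family.
--
-- For n < 3 the graph has no edges at all, so F = 1.

open import Defs
open import Algebra.Bundles using (CommutativeMonoid)
import Algebra.Properties.CommutativeMonoid.Sum as MonoidSum
open import Data.Bool using (Bool; true; false; if_then_else_; T)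
import Data.Bool as Bool
open import Data.Empty using (⊥-elim)
open import Data.Fin using (Fin; zero; suc; toℕ; punchIn; punchOut; fromℕ; fromℕ<)
open import Data.Fin.Patterns using (0F; 1F; 2F)
open import Data.Fin.Properties
  using (punchIn-punchOut; punchOut-injective; punchIn-injective; punchInᵢ≢i; toℕ-injective;
         toℕ-fromℕ; toℕ-fromℕ<; toℕ<n)
  renaming (suc-injective to Fin-suc-injective)
open import Data.List using (List; []; _∷_; length; map; _++_)
open import Data.List.Properties using (length-map; length-++)
open import Data.List.Relation.Unary.All as All using (All; []; _∷_)
import Data.List.Relation.Unary.All.Properties as All
open import Data.List.Relation.Unary.AllPairs as AllPairs using (AllPairs; []; _∷_)
import Data.List.Relation.Unary.AllPairs.Properties as AllPairs
open import Data.Nat using (ℕ; zero; suc; _+_; _<_; _≤_; _<ᵇ_; z≤n; s≤s; _≤′_; ≤′-reflexive; ≤′-step)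
open import Data.Nat.Combinatorics using (_C_; nCn≡1; nCk+nC[k+1]≡[n+1]C[k+1])
open import Data.Nat.Properties
  using (module ≤-Reasoning; +-0-commutativeMonoid; +-mono-≤; ≤-refl; ≤-trans; ≤-pred; <⇒≤; ≤⇒≯; <⇒≱; m≤n⇒m≤1+n; ≤∧≢⇒<;
         +-suc; +-identityʳ; n<1+n; 0≢1+n; m+1+n≢m; <ᵇ⇒<; <⇒<ᵇ; ≤⇒≤′; ≤′⇒≤)
  renaming (suc-injective to ℕ-suc-injective; _≟_ to _≟ℕ_)
open import Data.Product using (_×_; _,_; ∃)
import Data.Sum as Sum
open import Data.Sum using (inj₁; inj₂)
open import Data.Vec.Functional using (Vector; removeAt; tail)
open import Function using (_∘_; id)
open import Function.Consequences.Propositional using (inverseʳ⇒injective; strictlyInverseʳ⇒inverseʳ)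
open import Function.Definitions using (Injective)
open import Relation.Binary.PropositionalEquality using (_≡_; _≢_; refl; sym; trans; cong; cong₂; subst)
open import Relation.Nullary using (¬_; Dec; yes; no; does)

module Reindexing {c ℓ} (M : CommutativeMonoid c ℓ) where

  open CommutativeMonoid M using (Carrier; _≈_; _∙_; ∙-congˡ; setoid) renaming (refl to ≈-refl)
  open MonoidSum M using (sum; sum-remove; sum-cong-≗)
  open import Relation.Binary.Reasoning.Setoid setoid

  sum-reindex : ∀ {n} (f : Fin n → Fin n) → Injective _≡_ _≡_ f →
                (t : Vector Carrier n) → sum (t ∘ f) ≈ sum t
  sum-reindex {zero} f f-inj t = ≈-refl
  sum-reindex {suc n} f f-inj t = begin
    t (f zero) ∙ sum (t ∘ f ∘ suc)
      ≡⟨ cong (t (f zero) ∙_) (sum-cong-≗ (λ i → cong t (sym (punchIn-punchOut (fresh i))))) ⟩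
    t (f zero) ∙ sum (removeAt t (f zero) ∘ g)
      ≈⟨ ∙-congˡ (sum-reindex g g-inj (removeAt t (f zero))) ⟩
    t (f zero) ∙ sum (removeAt t (f zero))
      ≈⟨ sum-remove {i = f zero} t ⟨
    sum t ∎
    where
    fresh : ∀ i → f zero ≢ f (suc i)
    fresh i eq with f-inj eq
    ... | ()
    -- f on the positions ≥ 1, its range Fin (suc n) - f zero renumbered as Fin n
    g : Fin n → Fin n
    g i = punchOut (fresh i)
    g-inj : Injective _≡_ _≡_ g
    g-inj eq = Fin-suc-injective (f-inj (punchOut-injective (fresh _) (fresh _) eq))

open MonoidSum +-0-commutativeMonoid using (sum; sum-replicate-zero)
open Reindexing +-0-commutativeMonoid using (sum-reindex)

Word : ℕ → Set
Word n = Fin n → Bool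

bit : Bool → ℕ
bit b = if b then 1 else 0

weight : ∀ {n} → Word n → ℕ
weight w = sum (bit ∘ w)

Differ : ∀ {n} → Word n → Word n → Set
Differ w w′ = ∃ λ i → w i ≢ w′ i

branch : ∀ {k} → Bool → List (Word (suc k)) → List (Word k)
branch b [] = []
branch b (w ∷ ws) = if does (w zero Bool.≟ b) then tail w ∷ branch b ws else branch b ws

length-branches : ∀ {k} (ws : List (Word (suc k))) →
                  length ws ≡ length (branch true ws) + length (branch false ws)
length-branches [] = refl
length-branches (w ∷ ws) with w zero
... | true = cong suc (length-branches ws)
... | false = trans (cong suc (length-branches ws)) (sym (+-suc _ _))

differ-in-tail : ∀ {k} {w v : Word (suc k)} → w zero ≡ v zero → Differ w v → Differ (tail w) (tail v)
differ-in-tail same (zero , w₀≢v₀) = ⊥-elim (w₀≢v₀ same)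
differ-in-tail same (suc i , wᵢ≢vᵢ) = i , wᵢ≢vᵢ

branch-differ : ∀ {k} b (ws : List (Word (suc k))) → AllPairs Differ ws → AllPairs Differ (branch b ws)
branch-differ b [] [] = []
branch-differ b (w ∷ ws) (w-ws ∷ ws-distinct) with w zero Bool.≟ b
... | yes w₀≡b = tails-differ ws w-ws ∷ branch-differ b ws ws-distinct
  where
  tails-differ : ∀ vs → All (Differ w) vs → All (Differ (tail w)) (branch b vs)
  tails-differ [] [] = []
  tails-differ (v ∷ vs) (w-v ∷ w-vs) with v zero Bool.≟ b
  ... | yes v₀≡b = differ-in-tail (trans w₀≡b (sym v₀≡b)) w-v ∷ tails-differ vs w-vs
  ... | no _ = tails-differ vs w-vs
... | no _ = branch-differ b ws ws-distinct

branch-weight : ∀ {k} a b (ws : List (Word (suc k))) →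
                All (λ w → weight w ≡ a) ws → All (λ w → bit b + weight w ≡ a) (branch b ws)
branch-weight a b [] [] = []
branch-weight a b (w ∷ ws) (w-weight ∷ ws-weight) with w zero Bool.≟ b
... | yes refl = w-weight ∷ branch-weight a b ws ws-weight
... | no _ = branch-weight a b ws ws-weight

no-negative-weight : ∀ {k} (ws : List (Word k)) → All (λ w → suc (weight w) ≡ 0) ws → length ws ≡ 0
no-negative-weight [] [] = refl
no-negative-weight (_ ∷ _) (() ∷ _)

words-bound : ∀ n a (ws : List (Word n)) → AllPairs Differ ws → All (λ w → weight w ≡ a) ws →
              length ws ≤ n C a
words-bound zero a [] _ _ = z≤n
words-bound zero a (_ ∷ []) _ (refl ∷ []) = ≤-refl
words-bound zero a (_ ∷ _ ∷ _) (((() , _) ∷ _) ∷ _) _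
words-bound (suc k) zero ws distinct weights = begin
  length ws                                          ≡⟨ length-branches ws ⟩
  length (branch true ws) + length (branch false ws)
    ≡⟨ cong (_+ length (branch false ws)) (no-negative-weight _ (branch-weight 0 true ws weights)) ⟩
  length (branch false ws)
    ≤⟨ words-bound k 0 _ (branch-differ false ws distinct) (branch-weight 0 false ws weights) ⟩
  k C 0 ∎
  where open ≤-Reasoning
words-bound (suc k) (suc b) ws distinct weights = begin
  length ws                                          ≡⟨ length-branches ws ⟩
  length (branch true ws) + length (branch false ws)
    ≤⟨ +-mono-≤ (words-bound k b _ (branch-differ true ws distinct)
                   (All.map ℕ-suc-injective (branch-weight (suc b) true ws weights)))
                (words-bound k (suc b) _ (branch-differ false ws distinct)
                   (branch-weight (suc b) false ws weights)) ⟩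
  k C b + k C suc b                                  ≡⟨ nCk+nC[k+1]≡[n+1]C[k+1] k b ⟩
  suc k C suc b ∎
  where open ≤-Reasoning

inA : ∀ {n} → ℕ → Fin n → Bool
inA a v = toℕ v <ᵇ a

profile : ∀ {n} → ℕ → (Fin n → Fin n) → Word n
profile a π = inA a ∘ π

parts-differ : ∀ {a u v} → u < a → a ≤ v → (u <ᵇ a) ≢ (v <ᵇ a)
parts-differ {a} {u} {v} u<a a≤v same = ≤⇒≯ a≤v (<ᵇ⇒< v a (subst T same (<⇒<ᵇ u<a)))

profile-differ : ∀ {n a} {π σ : Fin n → Fin n} → GDifferent n a π σ →
                 Differ (profile a π) (profile a σ)
profile-differ (i , inj₁ (u<a , a≤v , _)) = i , parts-differ u<a a≤v
profile-differ (i , inj₂ (u<a , a≤v , _)) = i , parts-differ u<a a≤v ∘ sym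

weight-inA : ∀ n a → a ≤ n → weight (inA {n} a) ≡ a
weight-inA n zero _ = sum-replicate-zero n
weight-inA (suc n) (suc a) (s≤s a≤n) = cong suc (weight-inA n a a≤n)

profile-weight : ∀ {n a} (π : Fin n → Fin n) → IsPermutation π → a ≤ n → weight (profile a π) ≡ a
profile-weight {n} {a} π π-perm a≤n = trans (sum-reindex π π-perm (bit ∘ inA a)) (weight-inA n a a≤n)

upper-bound : ∀ {n a} (fam : List (Fin n → Fin n)) → a ≤ n → IsGDiffFamily n a fam → length fam ≤ n C a
upper-bound {n} {a} fam a≤n (perms , distinct) =
  subst (_≤ n C a) (length-map (profile a) fam)
    (words-bound n a (map (profile a) fam)
      (AllPairs.map⁺ (AllPairs.map profile-differ distinct))
      (All.map⁺ (All.map {P = IsPermutation} (λ {π} π-perm → profile-weight π π-perm a≤n) perms)))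

edge-end-≥2 : ∀ {u a v} → u < a → a ≤ v → v ≢ a + u → 2 ≤ v
edge-end-≥2 {a = suc (suc _)} _ a≤v _ = ≤-trans (s≤s (s≤s z≤n)) a≤v
edge-end-≥2 {zero} {suc zero} {suc zero} _ _ v≢1 = ⊥-elim (v≢1 refl)
edge-end-≥2 {zero} {suc zero} {suc (suc _)} _ _ _ = s≤s (s≤s z≤n)
edge-end-≥2 {suc _} {suc zero} (s≤s ()) _ _

no-edges : ∀ {n a} {u v : Fin n} → n < 3 → ¬ Adj n a u v
no-edges {v = v} n<3 (inj₁ (u<a , a≤v , v≢)) =
  <⇒≱ (≤-trans (toℕ<n v) (≤-pred n<3)) (edge-end-≥2 u<a a≤v v≢)
no-edges {u = u} n<3 (inj₂ (v<a , a≤u , u≢)) =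
  <⇒≱ (≤-trans (toℕ<n u) (≤-pred n<3)) (edge-end-≥2 v<a a≤u u≢)

at-most-one : ∀ {n a} → n < 3 → (fam : List (Fin n → Fin n)) → IsGDiffFamily n a fam → length fam ≤ 1
at-most-one _ [] _ = z≤n
at-most-one _ (_ ∷ []) _ = ≤-refl
at-most-one n<3 (_ ∷ _ ∷ _) (_ , (((_ , adj) ∷ _) ∷ _)) = ⊥-elim (no-edges n<3 adj)

Achievable : ℕ → ℕ → ℕ → Set
Achievable n a k = ∃ λ (fam : List (Fin n → Fin n)) → IsGDiffFamily n a fam × length fam ≡ k

trivial-family : ∀ {n a} → Achievable n a 1
trivial-family = id ∷ [] , ((λ eq → eq) ∷ [] , [] ∷ []) , refl

cross-edge : ∀ {n a} {u v : Fin n} {p q : ℕ} → toℕ u ≡ p → toℕ v ≡ q →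
             p < a → a ≤ q → q ≢ a + p → CrossEdge n a u v
cross-edge refl refl p<a a≤q q≢ = p<a , a≤q , q≢

record Embedding (k a′ a : ℕ) (x : Fin (suc k)) : Set where
  field
    embed : Fin k → Fin (suc k)
    embed-injective : Injective _≡_ _≡_ embed
    embed-avoids : ∀ w → embed w ≢ x
    embed-edges : ∀ {u v} → CrossEdge k a′ u v → CrossEdge (suc k) a (embed u) (embed v)

  extend : (Fin k → Fin k) → Fin (suc k) → Fin (suc k)
  extend π zero = x
  extend π (suc i) = embed (π i)

  extend-permutation : ∀ {π} → IsPermutation π → IsPermutation (extend π)
  extend-permutation π-perm {zero} {zero} _ = refl
  extend-permutation π-perm {zero} {suc j} eq = ⊥-elim (embed-avoids _ (sym eq))
  extend-permutation π-perm {suc i} {zero} eq = ⊥-elim (embed-avoids _ eq)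
  extend-permutation π-perm {suc i} {suc j} eq = cong suc (π-perm (embed-injective eq))

  extend-different : ∀ {π σ} → GDifferent k a′ π σ → GDifferent (suc k) a (extend π) (extend σ)
  extend-different (i , adj) = suc i , Sum.map embed-edges embed-edges adj

  extend-family : ∀ {fam} → IsGDiffFamily k a′ fam → IsGDiffFamily (suc k) a (map extend fam)
  extend-family (perms , distinct) =
    All.map⁺ (All.map {P = IsPermutation} extend-permutation perms) ,
    AllPairs.map⁺ (AllPairs.map extend-different distinct)

open Embedding using (extend; extend-family)

-- Families extended by the two ends x, y of an edge are G-different from each other
-- at position 0, so together they form a family for G(k+1,a).
glue : ∀ {k a a₁ a₂ m₁ m₂} {x y : Fin (suc k)} →
       Embedding k a₁ a x → Embedding k a₂ a y → Adj (suc k) a x y →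
       Achievable k a₁ m₁ → Achievable k a₂ m₂ → Achievable (suc k) a (m₁ + m₂)
glue {k} {a} E₁ E₂ xy (fam₁ , valid₁ , refl) (fam₂ , valid₂ , refl) =
  map (extend E₁) fam₁ ++ map (extend E₂) fam₂ , valid (extend-family E₁ valid₁) (extend-family E₂ valid₂) ,
  trans (length-++ (map (extend E₁) fam₁)) (cong₂ _+_ (length-map _ fam₁) (length-map _ fam₂))
  where
  across : All (λ π → All (GDifferent (suc k) a π) (map (extend E₂) fam₂)) (map (extend E₁) fam₁)
  across = All.map⁺ (All.tabulate (λ _ → All.map⁺ (All.tabulate (λ _ → zero , xy))))
  valid : IsGDiffFamily (suc k) a (map (extend E₁) fam₁) → IsGDiffFamily (suc k) a (map (extend E₂) fam₂) →
          IsGDiffFamily (suc k) a (map (extend E₁) fam₁ ++ map (extend E₂) fam₂)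
  valid (perms₁ , distinct₁) (perms₂ , distinct₂) =
    All.++⁺ perms₁ perms₂ , AllPairs.++⁺ distinct₁ distinct₂ across

toℕ-punchIn-below : ∀ {n} (i : Fin (suc n)) (j : Fin n) → toℕ j < toℕ i → toℕ (punchIn i j) ≡ toℕ j
toℕ-punchIn-below (suc i) zero _ = refl
toℕ-punchIn-below (suc i) (suc j) (s≤s j<i) = cong suc (toℕ-punchIn-below i j j<i)

toℕ-punchIn-above : ∀ {n} (i : Fin (suc n)) (j : Fin n) → toℕ i ≤ toℕ j → toℕ (punchIn i j) ≡ suc (toℕ j)
toℕ-punchIn-above zero j _ = refl
toℕ-punchIn-above (suc i) (suc j) (s≤s i≤j) = cong suc (toℕ-punchIn-above i j i≤j)

-- Deleting the last vertex b of A from G(k+1,b+1) leaves a copy of G(k,b):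
-- the A-vertices stay, the B-vertices and the matching move up by one.
drop-last-of-A : ∀ {k b} {x : Fin (suc k)} → toℕ x ≡ b → Embedding k b (suc b) x
drop-last-of-A {k} {x = x} refl = record
  { embed = punchIn x
  ; embed-injective = punchIn-injective x _ _
  ; embed-avoids = punchInᵢ≢i x
  ; embed-edges = edges
  }
  where
  edges : ∀ {u v} → CrossEdge k (toℕ x) u v → CrossEdge (suc k) (suc (toℕ x)) (punchIn x u) (punchIn x v)
  edges {u} {v} (u<x , x≤v , v≢) =
    cross-edge (toℕ-punchIn-below x u u<x) (toℕ-punchIn-above x v x≤v)
               (m≤n⇒m≤1+n u<x) (s≤s x≤v) (v≢ ∘ ℕ-suc-injective)

drop-last-vertex : ∀ {k a} → Embedding k a a (fromℕ k)
drop-last-vertex {k} {a} = record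
  { embed = punchIn (fromℕ k)
  ; embed-injective = punchIn-injective (fromℕ k) _ _
  ; embed-avoids = punchInᵢ≢i (fromℕ k)
  ; embed-edges = edges
  }
  where
  unmoved : ∀ w → toℕ (punchIn (fromℕ k) w) ≡ toℕ w
  unmoved w = toℕ-punchIn-below (fromℕ k) w (subst (toℕ w <_) (sym (toℕ-fromℕ k)) (toℕ<n w))
  edges : ∀ {u v} → CrossEdge k a u v → CrossEdge (suc k) a (punchIn (fromℕ k) u) (punchIn (fromℕ k) v)
  edges {u} {v} (u<a , a≤v , v≢) = cross-edge (unmoved u) (unmoved v) u<a a≤v v≢

rotate : ∀ {k} → ℕ → Fin k → Fin (suc k)
rotate b w with toℕ w ≟ℕ b
... | yes _ = zero
... | no _ = suc w

toℕ-rotate-hit : ∀ {k b} {w : Fin k} → toℕ w ≡ b → toℕ (rotate b w) ≡ 0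
toℕ-rotate-hit {b = b} {w} w≡b with toℕ w ≟ℕ b
... | yes _ = refl
... | no w≢b = ⊥-elim (w≢b w≡b)

toℕ-rotate-miss : ∀ {k b} {w : Fin k} → toℕ w ≢ b → toℕ (rotate b w) ≡ suc (toℕ w)
toℕ-rotate-miss {b = b} {w} w≢b with toℕ w ≟ℕ b
... | yes w≡b = ⊥-elim (w≢b w≡b)
... | no _ = refl

rotate-injective : ∀ {k} b → Injective _≡_ _≡_ (rotate {k} b)
rotate-injective b {w} {w′} eq with toℕ w ≟ℕ b | toℕ w′ ≟ℕ b
... | yes w≡b | yes w′≡b = toℕ-injective (trans w≡b (sym w′≡b))
... | no _    | no _     = Fin-suc-injective eq
rotate-injective b {w} {w′} () | yes _ | no _
rotate-injective b {w} {w′} () | no _  | yes _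

-- Deleting the first B-vertex b+1 of G(k+1,b+1) leaves a copy of G(k,b+1): rotate
-- the A-vertices cyclically by one and move the B-vertices up by one.  The matched
-- pairs i+1 ~ b+2+i of the target are exactly the images of the matched pairs
-- i ~ b+1+i (i < b) of the source, so edges go to edges.
drop-first-of-B : ∀ {k b} {y : Fin (suc k)} → toℕ y ≡ suc b → Embedding k (suc b) (suc b) y
drop-first-of-B {k} {b} {y} y≡b+1 = record
  { embed = rotate b
  ; embed-injective = rotate-injective b
  ; embed-avoids = avoids
  ; embed-edges = edges
  }
  where
  avoids : ∀ w → rotate b w ≢ y
  avoids w eq with toℕ w ≟ℕ b
  ... | yes _ = 0≢1+n (trans (cong toℕ eq) y≡b+1)
  ... | no w≢b = w≢b (ℕ-suc-injective (trans (cong toℕ eq) y≡b+1))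
  edges : ∀ {u v} → CrossEdge k (suc b) u v → CrossEdge (suc k) (suc b) (rotate b u) (rotate b v)
  edges {u} {v} (u<a , a≤v , v≢) = edge (toℕ u ≟ℕ b)
    where
    v≢b : toℕ v ≢ b
    v≢b v≡b = ≤⇒≯ (subst (suc b ≤_) v≡b a≤v) (n<1+n b)
    v-moves : toℕ (rotate b v) ≡ suc (toℕ v)
    v-moves = toℕ-rotate-miss v≢b
    edge : Dec (toℕ u ≡ b) → CrossEdge (suc k) (suc b) (rotate b u) (rotate b v)
    edge (yes u≡b) = cross-edge (toℕ-rotate-hit u≡b) v-moves (s≤s z≤n) (m≤n⇒m≤1+n a≤v)
                       (λ eq → v≢b (trans (ℕ-suc-injective eq) (+-identityʳ b)))
    edge (no u≢b) = cross-edge (toℕ-rotate-miss u≢b) v-moves (s≤s (≤∧≢⇒< (≤-pred u<a) u≢b)) (m≤n⇒m≤1+n a≤v)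
                      (λ eq → v≢ (trans (ℕ-suc-injective eq) (+-suc b (toℕ u))))

shift₁ shift₂ : Fin 3 → Fin 3
shift₁ 0F = 2F
shift₁ 1F = 0F
shift₁ 2F = 1F
shift₂ 0F = 1F
shift₂ 1F = 2F
shift₂ 2F = 0F

shift₂∘shift₁ : ∀ i → shift₂ (shift₁ i) ≡ i
shift₂∘shift₁ 0F = refl
shift₂∘shift₁ 1F = refl
shift₂∘shift₁ 2F = refl

shift₁∘shift₂ : ∀ i → shift₁ (shift₂ i) ≡ i
shift₁∘shift₂ 0F = refl
shift₁∘shift₂ 1F = refl
shift₁∘shift₂ 2F = refl

cyclic-family : List (Fin 3 → Fin 3)
cyclic-family = id ∷ shift₁ ∷ shift₂ ∷ []

cyclic-permutations : All IsPermutation cyclic-family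
cyclic-permutations =
  (λ eq → eq) ∷
  inverseʳ⇒injective shift₁ (strictlyInverseʳ⇒inverseʳ {f⁻¹ = shift₂} shift₁ shift₂∘shift₁) ∷
  inverseʳ⇒injective shift₂ (strictlyInverseʳ⇒inverseʳ {f⁻¹ = shift₁} shift₂ shift₁∘shift₂) ∷ []

-- G(3,1) has the single edge 0–2, G(3,2) the single edge 1–2; in each of them
-- any two members of the cyclic family meet that edge at some position.
edge-0-2 : CrossEdge 3 1 0F 2F
edge-0-2 = s≤s z≤n , s≤s z≤n , λ ()

edge-1-2 : CrossEdge 3 2 1F 2F
edge-1-2 = s≤s (s≤s z≤n) , s≤s (s≤s z≤n) , λ ()

cyclic-distinct-1 : AllPairs (GDifferent 3 1) cyclic-family
cyclic-distinct-1 = ((0F , inj₁ edge-0-2) ∷ (2F , inj₂ edge-0-2) ∷ [])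
                  ∷ ((1F , inj₁ edge-0-2) ∷ [])
                  ∷ [] ∷ []

cyclic-distinct-2 : AllPairs (GDifferent 3 2) cyclic-family
cyclic-distinct-2 = ((2F , inj₂ edge-1-2) ∷ (1F , inj₁ edge-1-2) ∷ [])
                  ∷ ((0F , inj₂ edge-1-2) ∷ [])
                  ∷ [] ∷ []

achievable-3 : ∀ {a} → a ≤ 3 → Achievable 3 a (3 C a)
achievable-3 {0} _ = trivial-family
achievable-3 {1} _ = cyclic-family , (cyclic-permutations , cyclic-distinct-1) , refl
achievable-3 {2} _ = cyclic-family , (cyclic-permutations , cyclic-distinct-2) , refl
achievable-3 {3} _ = trivial-family
achievable-3 {suc (suc (suc (suc _)))} (s≤s (s≤s (s≤s ())))

-- In G(k+1,b+1) with b < k and k ≥ 3, some B-vertex y is adjacent to the A-vertex x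
-- with label b and has G(k,b+1) embedded into G(k+1,b+1) - y: for b = 0 the last
-- vertex k, for b ≥ 1 the first B-vertex b+1 (the partner of x is 2b+1).
B-partner : ∀ {k b} → 3 ≤ k → b < k → (x : Fin (suc k)) → toℕ x ≡ b →
            ∃ λ y → Embedding k (suc b) (suc b) y × Adj (suc k) (suc b) x y
B-partner {k} {zero} 3≤k _ x x≡0 =
  fromℕ k , drop-last-vertex ,
  inj₁ (cross-edge x≡0 (toℕ-fromℕ k) (s≤s z≤n) (≤-trans (s≤s z≤n) 3≤k) k≢1)
  where
  k≢1 : k ≢ 1
  k≢1 k≡1 = ≤⇒≯ (subst (3 ≤_) k≡1 3≤k) (s≤s (s≤s z≤n))
B-partner {k} {suc c} _ b<k x x≡b =
  fromℕ< (s≤s b<k) , drop-first-of-B (toℕ-fromℕ< (s≤s b<k)) ,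
  inj₁ (cross-edge x≡b (toℕ-fromℕ< (s≤s b<k)) (n<1+n (suc c)) ≤-refl (m+1+n≢m (suc (suc c)) ∘ sym))

lower-bound-step : ∀ {k} → 3 ≤ k → (∀ {a} → a ≤ k → Achievable k a (k C a)) →
                   ∀ {a} → a ≤ suc k → Achievable (suc k) a (suc k C a)
lower-bound-step _ _ {zero} _ = trivial-family
lower-bound-step {k} 3≤k ih {suc b} b<1+k with b ≟ℕ k
... | yes refl = subst (Achievable (suc k) (suc k)) (sym (nCn≡1 (suc k))) trivial-family
... | no b≢k = pascal-step (≤∧≢⇒< (≤-pred b<1+k) b≢k)
  where
  pascal-step : b < k → Achievable (suc k) (suc b) (suc k C suc b)
  pascal-step b<k with B-partner 3≤k b<k (fromℕ< b<1+k) (toℕ-fromℕ< b<1+k)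
  ... | _ , drop-y , xy =
    subst (Achievable (suc k) (suc b)) (nCk+nC[k+1]≡[n+1]C[k+1] k b)
      (glue (drop-last-of-A (toℕ-fromℕ< b<1+k)) drop-y xy (ih (<⇒≤ b<k)) (ih b<k))

lower-bound : ∀ {n a} → 3 ≤′ n → a ≤ n → Achievable n a (n C a)
lower-bound (≤′-reflexive refl) = achievable-3
lower-bound (≤′-step 3≤′k) = lower-bound-step (≤′⇒≤ 3≤′k) (lower-bound 3≤′k)

theorem1 : ∀ (n a : ℕ) → a ≤ n →
    (n < 3 → FIs n a 1) × (3 ≤ n → FIs n a (n C a))
theorem1 n a a≤n = small , large
  where
  small : n < 3 → FIs n a 1
  small n<3 = trivial-family , at-most-one n<3
  large : 3 ≤ n → FIs n a (n C a)
  large 3≤n = lower-bound (≤⇒≤′ 3≤n) a≤n , λ fam → upper-bound fam a≤n
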